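{- Let $N\ge0$, let $\mathcal S\subseteq\Omega_N\cup\{V\}$ with $U_N\in\mathcal S$, and put $\mathcal V=\mathcal S\cup\{V\}$, $\mathcal N=\mathcal S\setminus\{V\}$. Then for $n\ge1$ and $m\in\mathbb Z$, $$|\mathcal F_{\mathcal V}(m,n)|=\sum_{j=0}^{Nn+m}\binom{n+j}{j}|\mathcal F_{\mathcal N}(m-j,n)|,\qquad |\mathcal P_{\mathcal V}(1,n)|=\frac1n\sum_{j=0}^{Nn+1}\binom{n+j-1}{j}|\mathcal F_{\mathcal N}(1-j,n)|.$$
   Context: Steps: $V=(0,-1)$ and $S_k=(1,k)$ for $k\in\mathbb Z$; $U_k=S_k$ for $k\ge0$, $D_j=S_{ -j}$ for $j\ge1$. $\Omega_N=\{S_k:k\le N\}$. For a set of steps $\mathcal S$, an $\mathcal S$-path is a finite sequence of steps from $\mathcal S$ starting at $(0,0)$. $\mathcal F_{\mathcal S}(m,n)$ is the set of $\mathcal S$-paths ending at $(n,-m)$; $\mathcal P_{\mathcal S}(m,n)$ is the subset of those all of whose points except possibly the last lie on or above the $x$-axis. An empty sum is $0$. -}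

module Defs where

open import Data.Bool using (Bool; true; false; _∧_; _∨_; not; T)
open import Data.Nat using (ℕ; zero; suc)
import Data.Nat as ℕ
open import Data.Integer using (ℤ; +_; -[1+_]; _+_; -_; _≤_; 0ℤ; 1ℤ)
open import Data.List using (List; []; _∷_; map; upTo)
open import Data.Nat.ListAction using (sum)
open import Data.List.Relation.Unary.All using (All)
open import Data.Product using (Σ; _×_; _,_)
open import Data.Unit using (⊤)
open import Data.Fin using (Fin)
open import Function.Bundles using (_↔_)
open import Relation.Binary.PropositionalEquality using (_≡_)

-- Steps: V = (0,-1) and S k = (1,k), k ∈ ℤ.
data Step : Set where
  V : Step
  S : ℤ → Step

isV : Step → Bool
isV V     = true
isV (S _) = false

StepSet : Set
StepSet = Step → Bool

withV : StepSet → StepSet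
withV 𝒮 s = isV s ∨ 𝒮 s

withoutV : StepSet → StepSet
withoutV 𝒮 s = not (isV s) ∧ 𝒮 s

dx : Step → ℤ
dx V     = 0ℤ
dx (S _) = 1ℤ

dy : Step → ℤ
dy V     = - 1ℤ
dy (S k) = k

endX : List Step → ℤ
endX []      = 0ℤ
endX (s ∷ p) = dx s + endX p

endY : List Step → ℤ
endY []      = 0ℤ
endY (s ∷ p) = dy s + endY p

IsPath : StepSet → List Step → Set
IsPath 𝒮 p = All (λ s → T (𝒮 s)) p

F : StepSet → ℤ → ℕ → Set
F 𝒮 m n = Σ (List Step) λ p → IsPath 𝒮 p × (endX p ≡ + n) × (endY p ≡ - m)

AboveExceptLast : ℤ → List Step → Set
AboveExceptLast h []      = ⊤
AboveExceptLast h (s ∷ p) = (0ℤ ≤ h) × AboveExceptLast (dy s + h) p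

P : StepSet → ℤ → ℕ → Set
P 𝒮 m n = Σ (List Step) λ p →
  IsPath 𝒮 p × (endX p ≡ + n) × (endY p ≡ - m) × AboveExceptLast 0ℤ p

HasSize : Set → ℕ → Set
HasSize A k = A ↔ Fin k

sumUpTo : ℤ → (ℕ → ℕ) → ℕ
sumUpTo (+ u)      f = sum (map f (upTo (suc u)))
sumUpTo -[1+ _ ]   f = 0

-- A 𝒱-path is the interleaving of its shape (the word recording which of its steps
-- are V) with the 𝒩-path left after deleting its V-steps. Deleting j V-steps raises
-- the endpoint by j, there are C(n+j, j) shapes with j V-steps and n S-steps, and an
-- 𝒩-path with n steps ends at height at most Nn, so only j ≤ Nn + m contribute.
-- The second identity is the cycle lemma: cutting a path of 𝒫_𝒱(1,n) just after one
-- of its n S-steps and swapping the two pieces is a bijection onto the 𝒱-paths to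
-- (n,-1) whose last step is an S-step; the inverse cuts such a path in front of its
-- longest suffix that stays on or above the axis until its last point. These paths
-- are counted as before, now with the C(n-1+j, j) shapes that end in an S-step.
module Submission where

open import Defs
open import Axiom.UniquenessOfIdentityProofs using (module Decidable⇒UIP)
open import Data.Bool using (Bool; true; false; T; not)
open import Data.Bool.Properties using (T-irrelevant)
open import Data.Empty using (⊥; ⊥-elim)
open import Data.Fin using (Fin; zero; toℕ; fromℕ<)
open import Data.Fin.Permutation using (↔⇒≡)
import Data.Fin.Properties as Fin
open import Data.Integer using (ℤ; +_; -[1+_]; _+_; _-_; -_; 0ℤ; 1ℤ; +≤+; -≤+) renaming (_≤_ to _≤ℤ_)
import Data.Integer.Properties as ℤ
open import Data.Integer.Tactic.RingSolver using (solve-∀)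
open import Data.List using (List; []; _∷_; _++_; _∷ʳ_; map; length; applyUpTo)
open import Data.List.Properties using (map-upTo; map-++)
open import Data.List.Relation.Unary.All using (All; []; _∷_)
import Data.List.Relation.Unary.All as All
open import Data.List.Relation.Unary.All.Properties using (++⁺; ++⁻)
open import Data.Nat using (ℕ; zero; suc; pred; _≤_; _<_; _∸_; z≤n; s≤s; >-nonZero)
open import Data.Nat using () renaming (_+_ to _+ℕ_; _*_ to _*ℕ_)
import Data.Nat.Properties as ℕ
open import Data.Nat.Combinatorics using (_C_; nCn≡1; nCk+nC[k+1]≡[n+1]C[k+1])
open import Data.Nat.ListAction using (sum)
open import Data.Product using (Σ; _×_; _,_; proj₁; proj₂; map₁; map₂; swap)
open import Data.Product.Function.NonDependent.Propositional using (_×-↔_)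
open import Data.Sum using (_⊎_; inj₁; inj₂)
open import Data.Sum.Function.Propositional using (_⊎-↔_)
open import Data.Unit using (⊤; tt)
open import Function using (_∘_; case_of_)
open import Function.Bundles using (_↔_; mk↔ₛ′)
open import Function.Properties.Inverse using (↔-refl; ↔-sym; ↔-trans)
open import Relation.Binary.PropositionalEquality
open import Relation.Nullary using (¬_; Dec; yes; no; _×-dec_)
open import Relation.Nullary.Irrelevant using (Irrelevant)

private
  variable
    A B : Set

-- Finite cardinalities

HasSize-unique : {k l : ℕ} → HasSize A k → HasSize A l → k ≡ l
HasSize-unique A≅k A≅l = ↔⇒≡ (↔-trans (↔-sym A≅k) A≅l)

HasSize-⊥ : ¬ A → HasSize A 0
HasSize-⊥ ¬a = mk↔ₛ′ (⊥-elim ∘ ¬a) (λ ()) (λ ()) (⊥-elim ∘ ¬a)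

HasSize-irrelevant : Irrelevant A → A → HasSize A 1
HasSize-irrelevant irr a = mk↔ₛ′ (λ _ → zero) (λ _ → a) (λ { zero → refl }) (irr a)

HasSize-⊎ : {k l : ℕ} → HasSize A k → HasSize B l → HasSize (A ⊎ B) (k +ℕ l)
HasSize-⊎ A≅k B≅l = ↔-trans (A≅k ⊎-↔ B≅l) (↔-sym Fin.+↔⊎)

HasSize-× : {k l : ℕ} → HasSize A k → HasSize B l → HasSize (A × B) (k *ℕ l)
HasSize-× A≅k B≅l = ↔-trans (A≅k ×-↔ B≅l) (↔-sym Fin.*↔×)

Σℕ-↔ : (X : ℕ → Set) → Σ ℕ X ↔ (X 0 ⊎ Σ ℕ (X ∘ suc))
Σℕ-↔ X = mk↔ₛ′ to from
  (λ { (inj₁ _) → refl ; (inj₂ _) → refl }) (λ { (zero , _) → refl ; (suc _ , _) → refl })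
  where
  to : Σ ℕ X → X 0 ⊎ Σ ℕ (X ∘ suc)
  to (zero  , x) = inj₁ x
  to (suc j , x) = inj₂ (j , x)
  from : X 0 ⊎ Σ ℕ (X ∘ suc) → Σ ℕ X
  from (inj₁ x)       = zero , x
  from (inj₂ (j , x)) = suc j , x

HasSize-Σℕ : (u : ℕ) {X : ℕ → Set} {g : ℕ → ℕ} → (∀ j → HasSize (X j) (g j)) →
  (∀ j → X j → j < u) → HasSize (Σ ℕ X) (sum (applyUpTo g u))
HasSize-Σℕ zero    _   bounded = HasSize-⊥ λ (j , x) → ℕ.n≮0 (bounded j x)
HasSize-Σℕ (suc u) X≅g bounded = ↔-trans (Σℕ-↔ _)
  (HasSize-⊎ (X≅g 0) (HasSize-Σℕ u (X≅g ∘ suc) λ j x → ℕ.≤-pred (bounded (suc j) x)))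

HasSize-Σ-sumUpTo : (K : ℤ) {X : ℕ → Set} {g : ℕ → ℕ} → (∀ j → HasSize (X j) (g j)) →
  (∀ j → X j → + j ≤ℤ K) → HasSize (Σ ℕ X) (sumUpTo K g)
HasSize-Σ-sumUpTo (+ u) {g = g} X≅g bounded =
  subst (HasSize _) (cong sum (sym (map-upTo g (suc u))))
    (HasSize-Σℕ (suc u) X≅g λ j x → s≤s (ℤ.drop‿+≤+ (bounded j x)))
HasSize-Σ-sumUpTo -[1+ u ] _ bounded = HasSize-⊥ λ (j , x) → case bounded j x of λ ()

×-irrelevant : Irrelevant A → Irrelevant B → Irrelevant (A × B)
×-irrelevant irrA irrB (a , b) (a′ , b′) = cong₂ _,_ (irrA a a′) (irrB b b′)

ℤ-≡-irrelevant : {i j : ℤ} → Irrelevant (i ≡ j)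
ℤ-≡-irrelevant = Decidable⇒UIP.≡-irrelevant ℤ._≟_

Σ-≡-irrelevant : {P : A → Set} → (∀ a → Irrelevant (P a)) →
  {x y : Σ A P} → proj₁ x ≡ proj₁ y → x ≡ y
Σ-≡-irrelevant irr {a , p} {_ , q} refl = cong (a ,_) (irr a p q)

subset-↔ : {P : A → Set} {Q : B → Set} → (∀ a → Irrelevant (P a)) → (∀ b → Irrelevant (Q b)) →
  (f : A → B) (g : B → A) → (∀ {a} → P a → Q (f a)) → (∀ {b} → Q b → P (g b)) →
  (∀ {a} → P a → g (f a) ≡ a) → (∀ {b} → Q b → f (g b) ≡ b) → Σ A P ↔ Σ B Q
subset-↔ irrP irrQ f g f-pres g-pres gf fg =
  mk↔ₛ′ (λ (a , p) → f a , f-pres p) (λ (b , q) → g b , g-pres q)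
    (λ (_ , q) → Σ-≡-irrelevant irrQ (fg q)) (λ (_ , p) → Σ-≡-irrelevant irrP (gf p))

Σ-⇔-↔ : {P Q : A → Set} → (∀ a → Irrelevant (P a)) → (∀ a → Irrelevant (Q a)) →
  (∀ {a} → P a → Q a) → (∀ {a} → Q a → P a) → Σ A P ↔ Σ A Q
Σ-⇔-↔ irrP irrQ p⇒q q⇒p =
  subset-↔ irrP irrQ (λ a → a) (λ a → a) p⇒q q⇒p (λ _ → refl) (λ _ → refl)

Fin-×-↔ : {P : A → Set} (n : ℕ) → (∀ a → Irrelevant (P a)) →
  (Fin n × Σ A P) ↔ Σ (ℕ × A) (λ (i , a) → i < n × P a)
Fin-×-↔ n irr = mk↔ₛ′
  (λ (i , a , p) → (toℕ i , a) , Fin.toℕ<n i , p)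
  (λ ((i , a) , i<n , p) → fromℕ< i<n , a , p)
  (λ ((_ , a) , i<n , _) →
    Σ-≡-irrelevant (λ _ → ×-irrelevant ℕ.<-irrelevant (irr _)) (cong (_, a) (Fin.toℕ-fromℕ< i<n)))
  (λ (i , a , p) → cong (_, a , p) (Fin.fromℕ<-toℕ i _))

-- Shapes

Shape : Set
Shape = List Bool

#V : Shape → ℕ
#V []          = 0
#V (true  ∷ w) = suc (#V w)
#V (false ∷ w) = #V w

#S : Shape → ℕ
#S []          = 0
#S (true  ∷ w) = #S w
#S (false ∷ w) = suc (#S w)

#V-++ : ∀ u w → #V (u ++ w) ≡ #V u +ℕ #V w
#V-++ []          w = refl
#V-++ (true  ∷ u) w = cong suc (#V-++ u w)
#V-++ (false ∷ u) w = #V-++ u w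

#S-++ : ∀ u w → #S (u ++ w) ≡ #S u +ℕ #S w
#S-++ []          w = refl
#S-++ (true  ∷ u) w = #S-++ u w
#S-++ (false ∷ u) w = cong suc (#S-++ u w)

HasCounts : ℕ → ℕ → Shape → Set
HasCounts j n w = #V w ≡ j × #S w ≡ n

Shapes : (Shape → Bool) → ℕ → ℕ → Set
Shapes r j n = Σ Shape λ w → HasCounts j n w × T (r w)

AllShapes : ℕ → ℕ → Set
AllShapes = Shapes (λ _ → true)

Shapes-irrelevant : ∀ (r : Shape → Bool) j n w → Irrelevant (HasCounts j n w × T (r w))
Shapes-irrelevant r j n w = ×-irrelevant (×-irrelevant ℕ.≡-irrelevant ℕ.≡-irrelevant) (T-irrelevant {r w})

Σ-Shape-↔ : (P : Shape → Set) →
  Σ Shape P ↔ (P [] ⊎ (Σ Shape (P ∘ (true ∷_)) ⊎ Σ Shape (P ∘ (false ∷_))))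
Σ-Shape-↔ P = mk↔ₛ′ to from
  (λ { (inj₁ _) → refl ; (inj₂ (inj₁ _)) → refl ; (inj₂ (inj₂ _)) → refl })
  (λ { ([] , _) → refl ; (true ∷ _ , _) → refl ; (false ∷ _ , _) → refl })
  where
  to : Σ Shape P → P [] ⊎ (Σ Shape (P ∘ (true ∷_)) ⊎ Σ Shape (P ∘ (false ∷_)))
  to ([]        , x) = inj₁ x
  to (true  ∷ w , x) = inj₂ (inj₁ (w , x))
  to (false ∷ w , x) = inj₂ (inj₂ (w , x))
  from : P [] ⊎ (Σ Shape (P ∘ (true ∷_)) ⊎ Σ Shape (P ∘ (false ∷_))) → Σ Shape P
  from (inj₁ x)              = [] , x
  from (inj₂ (inj₁ (w , x))) = true ∷ w , x
  from (inj₂ (inj₂ (w , x))) = false ∷ w , x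

HasSize-Σ-Shape : {P : Shape → Set} {a b c : ℕ} → HasSize (P []) a →
  HasSize (Σ Shape (P ∘ (true ∷_))) b → HasSize (Σ Shape (P ∘ (false ∷_))) c →
  HasSize (Σ Shape P) (a +ℕ (b +ℕ c))
HasSize-Σ-Shape P[]≅a V∷≅b S∷≅c =
  ↔-trans (Σ-Shape-↔ _) (HasSize-⊎ P[]≅a (HasSize-⊎ V∷≅b S∷≅c))

V∷-↔ : ∀ (r : Shape → Bool) j n →
  Σ Shape (λ w → HasCounts (suc j) n (true ∷ w) × T (r (true ∷ w))) ↔ Shapes (r ∘ (true ∷_)) j n
V∷-↔ r j n = Σ-⇔-↔ (Shapes-irrelevant r (suc j) n ∘ (true ∷_)) (Shapes-irrelevant (r ∘ (true ∷_)) j n)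
  (λ ((v , s) , t) → (ℕ.suc-injective v , s) , t) (λ ((v , s) , t) → (cong suc v , s) , t)

S∷-↔ : ∀ (r : Shape → Bool) j n →
  Σ Shape (λ w → HasCounts j (suc n) (false ∷ w) × T (r (false ∷ w))) ↔ Shapes (r ∘ (false ∷_)) j n
S∷-↔ r j n = Σ-⇔-↔ (Shapes-irrelevant r j (suc n) ∘ (false ∷_)) (Shapes-irrelevant (r ∘ (false ∷_)) j n)
  (λ ((v , s) , t) → (v , ℕ.suc-injective s) , t) (λ ((v , s) , t) → (v , cong suc s) , t)

pascal : ∀ n j → (suc n +ℕ j) C j +ℕ (n +ℕ suc j) C suc j ≡ (suc n +ℕ suc j) C suc j
pascal n j = begin
  (suc n +ℕ j) C j +ℕ (n +ℕ suc j) C suc j   ≡⟨ cong (λ x → (suc n +ℕ j) C j +ℕ x C suc j) (ℕ.+-suc n j) ⟩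
  (suc n +ℕ j) C j +ℕ (suc n +ℕ j) C suc j   ≡⟨ nCk+nC[k+1]≡[n+1]C[k+1] (suc n +ℕ j) j ⟩
  suc (suc n +ℕ j) C suc j                   ≡⟨ cong (_C suc j) (sym (ℕ.+-suc (suc n) j)) ⟩
  (suc n +ℕ suc j) C suc j                   ∎
  where open ≡-Reasoning

AllShapes-size : ∀ j n → HasSize (AllShapes j n) ((n +ℕ j) C j)
AllShapes-size zero zero = HasSize-Σ-Shape
  (HasSize-irrelevant (Shapes-irrelevant (λ _ → true) 0 0 []) ((refl , refl) , tt))
  (HasSize-⊥ λ { (_ , (() , _) , _) }) (HasSize-⊥ λ { (_ , (_ , ()) , _) })
AllShapes-size (suc j) zero = subst (HasSize _) size (HasSize-Σ-Shape
  (HasSize-⊥ λ { ((() , _) , _) })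
  (↔-trans (V∷-↔ (λ _ → true) j 0) (AllShapes-size j 0))
  (HasSize-⊥ λ { (_ , (_ , ()) , _) }))
  where
  size : j C j +ℕ 0 ≡ suc j C suc j
  size = trans (ℕ.+-identityʳ _) (trans (nCn≡1 j) (sym (nCn≡1 (suc j))))
AllShapes-size zero (suc n) = HasSize-Σ-Shape
  (HasSize-⊥ λ { ((_ , ()) , _) })
  (HasSize-⊥ λ { (_ , (() , _) , _) })
  (↔-trans (S∷-↔ (λ _ → true) 0 n) (AllShapes-size 0 n))
AllShapes-size (suc j) (suc n) = subst (HasSize _) (pascal n j) (HasSize-Σ-Shape
  (HasSize-⊥ λ { ((() , _) , _) })
  (↔-trans (V∷-↔ (λ _ → true) j (suc n)) (AllShapes-size j (suc n)))
  (↔-trans (S∷-↔ (λ _ → true) (suc j) n) (AllShapes-size (suc j) n)))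

endsInS : Shape → Bool
endsInS []          = false
endsInS (b ∷ [])    = not b
endsInS (_ ∷ b ∷ w) = endsInS (b ∷ w)

NonEmpty : List A → Set
NonEmpty []      = ⊥
NonEmpty (_ ∷ _) = ⊤

endsInS-++ : ∀ u w → NonEmpty w → endsInS (u ++ w) ≡ endsInS w
endsInS-++ []          _       _  = refl
endsInS-++ (_ ∷ [])    (_ ∷ _) _  = refl
endsInS-++ (_ ∷ b ∷ u) w       ne = endsInS-++ (b ∷ u) w ne

endsInS⇒0<#S : ∀ w → T (endsInS w) → 0 < #S w
endsInS⇒0<#S (false ∷ _)     _     = s≤s z≤n
endsInS⇒0<#S (true  ∷ b ∷ w) endsS = endsInS⇒0<#S (b ∷ w) endsS

endsInS-∷ : ∀ b w → T (endsInS w) → T (endsInS (b ∷ w))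
endsInS-∷ _ (_ ∷ _) endsS = endsS

dropLast : Shape → Shape
dropLast []          = []
dropLast (_ ∷ [])    = []
dropLast (a ∷ b ∷ w) = a ∷ dropLast (b ∷ w)

endsInS-∷ʳ : ∀ w → T (endsInS (w ∷ʳ false))
endsInS-∷ʳ []          = tt
endsInS-∷ʳ (_ ∷ [])    = tt
endsInS-∷ʳ (_ ∷ b ∷ w) = endsInS-∷ʳ (b ∷ w)

dropLast-∷ʳ : ∀ w b → dropLast (w ∷ʳ b) ≡ w
dropLast-∷ʳ []          _ = refl
dropLast-∷ʳ (_ ∷ [])    _ = refl
dropLast-∷ʳ (a ∷ c ∷ w) b = cong (a ∷_) (dropLast-∷ʳ (c ∷ w) b)

dropLast-∷ʳ-false : ∀ w → T (endsInS w) → dropLast w ∷ʳ false ≡ w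
dropLast-∷ʳ-false (false ∷ []) _     = refl
dropLast-∷ʳ-false (a ∷ b ∷ w)  endsS = cong (a ∷_) (dropLast-∷ʳ-false (b ∷ w) endsS)

#V-∷ʳ-false : ∀ w → #V (w ∷ʳ false) ≡ #V w
#V-∷ʳ-false w = trans (#V-++ w _) (ℕ.+-identityʳ (#V w))

#S-∷ʳ-false : ∀ w → #S (w ∷ʳ false) ≡ suc (#S w)
#S-∷ʳ-false w = trans (#S-++ w _) (ℕ.+-comm (#S w) 1)

AllShapes↔Shapes-endsInS : ∀ j n → AllShapes j n ↔ Shapes endsInS j (suc n)
AllShapes↔Shapes-endsInS j n =
  subset-↔ (Shapes-irrelevant _ j n) (Shapes-irrelevant endsInS j (suc n)) (_∷ʳ false) dropLast
    (λ {w} ((v , s) , _) → (trans (#V-∷ʳ-false w) v , trans (#S-∷ʳ-false w) (cong suc s)) , endsInS-∷ʳ w)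
    (λ {w} ((v , s) , endsS) → let w≡ = dropLast-∷ʳ-false w endsS in
      (trans (sym (#V-∷ʳ-false (dropLast w))) (trans (cong #V w≡) v) ,
       ℕ.suc-injective (trans (sym (#S-∷ʳ-false (dropLast w))) (trans (cong #S w≡) s))) , tt)
    (λ {w} _ → dropLast-∷ʳ w false)
    (λ {w} (_ , endsS) → dropLast-∷ʳ-false w endsS)

-- Separating the V-steps

shape : List Step → Shape
shape = map isV

dropV : List Step → List Step
dropV []        = []
dropV (V   ∷ p) = dropV p
dropV (S k ∷ p) = S k ∷ dropV p

interleave : Shape → List Step → List Step
interleave []          _       = []
interleave (true  ∷ w) q       = V ∷ interleave w q
interleave (false ∷ w) []      = []
interleave (false ∷ w) (s ∷ q) = s ∷ interleave w q

endX-shape : ∀ p → endX p ≡ + #S (shape p)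
endX-shape []        = refl
endX-shape (V   ∷ p) = trans (ℤ.+-identityˡ (endX p)) (endX-shape p)
endX-shape (S _ ∷ p) = cong (λ x → 1ℤ + x) (endX-shape p)

#S-shape : ∀ p {n} → endX p ≡ + n → #S (shape p) ≡ n
#S-shape p x = ℤ.+-injective (trans (sym (endX-shape p)) x)

endX-dropV : ∀ p → endX (dropV p) ≡ endX p
endX-dropV []        = refl
endX-dropV (V   ∷ p) = trans (endX-dropV p) (sym (ℤ.+-identityˡ (endX p)))
endX-dropV (S _ ∷ p) = cong (λ x → 1ℤ + x) (endX-dropV p)

endY-dropV : ∀ p → endY (dropV p) ≡ endY p + + #V (shape p)
endY-dropV []        = refl
endY-dropV (V   ∷ p) = trans (endY-dropV p) (shift (endY p) (+ #V (shape p)))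
  where
  shift : ∀ e v → e + v ≡ (- 1ℤ + e) + (1ℤ + v)
  shift = solve-∀
endY-dropV (S k ∷ p) = trans (cong (λ x → k + x) (endY-dropV p)) (sym (ℤ.+-assoc k (endY p) _))

interleave-shape-dropV : ∀ p → interleave (shape p) (dropV p) ≡ p
interleave-shape-dropV []        = refl
interleave-shape-dropV (V   ∷ p) = cong (V ∷_) (interleave-shape-dropV p)
interleave-shape-dropV (S k ∷ p) = cong (S k ∷_) (interleave-shape-dropV p)

module _ {𝒮 : StepSet} where

  dropV-path : ∀ {p} → IsPath (withV 𝒮) p → IsPath (withoutV 𝒮) (dropV p)
  dropV-path {[]}      []       = []
  dropV-path {V   ∷ _} (_ ∷ ps) = dropV-path ps
  dropV-path {S _ ∷ _} (s ∷ ps) = s ∷ dropV-path ps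

  interleave-path : ∀ w {q} → IsPath (withoutV 𝒮) q → IsPath (withV 𝒮) (interleave w q)
  interleave-path []          _                  = []
  interleave-path (true  ∷ w) qs                 = tt ∷ interleave-path w qs
  interleave-path (false ∷ w) []                 = []
  interleave-path (false ∷ w) {S _ ∷ _} (s ∷ qs) = s ∷ interleave-path w qs

  endX-V-free : ∀ {q} → IsPath (withoutV 𝒮) q → endX q ≡ + length q
  endX-V-free {[]}      []       = refl
  endX-V-free {S _ ∷ _} (_ ∷ qs) = cong (λ x → 1ℤ + x) (endX-V-free qs)

  length-V-free : ∀ {q n} → IsPath (withoutV 𝒮) q → endX q ≡ + n → length q ≡ n
  length-V-free qs x = ℤ.+-injective (trans (sym (endX-V-free qs)) x)

  shape-interleave : ∀ w {q} → IsPath (withoutV 𝒮) q → length q ≡ #S w → shape (interleave w q) ≡ w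
  shape-interleave []          _                  _ = refl
  shape-interleave (true  ∷ w) qs                 e = cong (true ∷_) (shape-interleave w qs e)
  shape-interleave (false ∷ w) {S _ ∷ _} (_ ∷ qs) e =
    cong (false ∷_) (shape-interleave w qs (ℕ.suc-injective e))

  dropV-interleave : ∀ w {q} → IsPath (withoutV 𝒮) q → length q ≡ #S w → dropV (interleave w q) ≡ q
  dropV-interleave []          []                 _ = refl
  dropV-interleave (true  ∷ w) qs                 e = dropV-interleave w qs e
  dropV-interleave (false ∷ w) []                 _ = refl
  dropV-interleave (false ∷ w) {S k ∷ _} (_ ∷ qs) e =
    cong (S k ∷_) (dropV-interleave w qs (ℕ.suc-injective e))

  endY-interleave : ∀ w {q} → IsPath (withoutV 𝒮) q → length q ≡ #S w →
    endY (interleave w q) ≡ endY q - + #V w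
  endY-interleave w {q} qs len = begin
    endY p                                      ≡⟨ add-sub (endY p) (+ #V (shape p)) ⟩
    (endY p + + #V (shape p)) - + #V (shape p)  ≡⟨ cong (_- + #V (shape p)) (endY-dropV p) ⟨
    endY (dropV p) - + #V (shape p)             ≡⟨ cong₂ (λ q′ w′ → endY q′ - + #V w′) (dropV-interleave w qs len)
                                                                                         (shape-interleave w qs len) ⟩
    endY q - + #V w                             ∎
    where
    open ≡-Reasoning
    p : List Step
    p = interleave w q
    add-sub : ∀ e v → e ≡ (e + v) - v
    add-sub = solve-∀

IsPath-irrelevant : ∀ 𝒮 p → Irrelevant (IsPath 𝒮 p)
IsPath-irrelevant 𝒮 p = All.irrelevant (λ {s} → T-irrelevant {𝒮 s})

PathTo : StepSet → ℤ → ℕ → List Step → Set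
PathTo 𝒮 m n p = IsPath 𝒮 p × endX p ≡ + n × endY p ≡ - m

PathTo-irrelevant : ∀ 𝒮 m n p → Irrelevant (PathTo 𝒮 m n p)
PathTo-irrelevant 𝒮 m n p =
  ×-irrelevant (IsPath-irrelevant 𝒮 p) (×-irrelevant ℤ-≡-irrelevant ℤ-≡-irrelevant)

FShaped : StepSet → (Shape → Bool) → ℤ → ℕ → Set
FShaped 𝒮 r m n = Σ (List Step) λ p → PathTo 𝒮 m n p × T (r (shape p))

module Decomposition (𝒮 : StepSet) (r : Shape → Bool) (m : ℤ) (n : ℕ) where

  Separated : ℕ × Shape × List Step → Set
  Separated (j , w , q) = (HasCounts j n w × T (r w)) × PathTo (withoutV 𝒮) (m - + j) n q

  separate : List Step → ℕ × Shape × List Step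
  separate p = #V (shape p) , shape p , dropV p

  combine : ℕ × Shape × List Step → List Step
  combine (_ , w , q) = interleave w q

  separate-pres : ∀ {p} → PathTo (withV 𝒮) m n p × T (r (shape p)) → Separated (separate p)
  separate-pres {p} ((ps , x , y) , rp) =
    ((refl , #S-shape p x) , rp) ,
    dropV-path ps , trans (endX-dropV p) x , trans (endY-dropV p) (trans (cong (_+ _) y) (neg-sub m _))
    where
    neg-sub : ∀ m j → - m + j ≡ - (m - j)
    neg-sub = solve-∀

  length≡#S : ∀ {j w q} → Separated (j , w , q) → length q ≡ #S w
  length≡#S (((_ , s) , _) , qs , x , _) = trans (length-V-free qs x) (sym s)

  combine-pres : ∀ {b} → Separated b → PathTo (withV 𝒮) m n (combine b) × T (r (shape (combine b)))
  combine-pres {j , w , q} sep@(((v , s) , rw) , qs , _ , y) =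
    (interleave-path w qs , trans (endX-shape p) (cong +_ (trans (cong #S shape≡) s)) , endY≡) ,
    subst (T ∘ r) (sym shape≡) rw
    where
    p : List Step
    p = interleave w q
    shape≡ : shape p ≡ w
    shape≡ = shape-interleave w qs (length≡#S sep)
    neg-sub-sub : ∀ m j → - (m - j) - j ≡ - m
    neg-sub-sub = solve-∀
    endY≡ : endY p ≡ - m
    endY≡ = trans (endY-interleave w qs (length≡#S sep))
                  (trans (cong₂ (λ e k → e - + k) y v) (neg-sub-sub m (+ j)))

  separate-combine : ∀ {b} → Separated b → separate (combine b) ≡ b
  separate-combine {j , w , q} sep@(((v , _) , _) , qs , _) = begin
    #V (shape p) , shape p , dropV p   ≡⟨ cong₂ (λ w′ q′ → #V w′ , w′ , q′) (shape-interleave w qs (length≡#S sep))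
                                                                          (dropV-interleave w qs (length≡#S sep)) ⟩
    #V w , w , q                       ≡⟨ cong (_, w , q) v ⟩
    j , w , q                          ∎
    where
    open ≡-Reasoning
    p : List Step
    p = interleave w q

  decompose : FShaped (withV 𝒮) r m n ↔ Σ ℕ (λ j → Shapes r j n × F (withoutV 𝒮) (m - + j) n)
  decompose = ↔-trans
    (subset-↔ (λ p → ×-irrelevant (PathTo-irrelevant _ m n p) (T-irrelevant {r (shape p)}))
      (λ (j , w , q) → ×-irrelevant (Shapes-irrelevant r j n w) (PathTo-irrelevant _ (m - + j) n q))
      separate combine separate-pres combine-pres (λ {p} _ → interleave-shape-dropV p) separate-combine)
    (mk↔ₛ′ (λ ((j , w , q) , c , d) → j , (w , c) , (q , d))
           (λ (j , (w , c) , (q , d)) → (j , w , q) , c , d)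
           (λ _ → refl) (λ _ → refl))

F↔FShaped : ∀ 𝒮 m n → F 𝒮 m n ↔ FShaped 𝒮 (λ _ → true) m n
F↔FShaped 𝒮 m n = mk↔ₛ′ (map₂ (_, tt)) (map₂ proj₁) (λ _ → refl) (λ _ → refl)

module _ {N : ℕ} {𝒮 : StepSet} (bounded : ∀ k → T (𝒮 (S k)) → k ≤ℤ + N) where

  endY-≤ : ∀ {q} → IsPath (withoutV 𝒮) q → endY q ≤ℤ + (N *ℕ length q)
  endY-≤ {[]}      []       = ℤ.≤-reflexive (cong +_ (sym (ℕ.*-zeroʳ N)))
  endY-≤ {S k ∷ q} (s ∷ qs) = ℤ.≤-trans (ℤ.+-mono-≤ (bounded k s) (endY-≤ qs))
                                        (ℤ.≤-reflexive (cong +_ (sym (ℕ.*-suc N (length q)))))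

  F-withoutV-index-≤ : ∀ {m j n} → F (withoutV 𝒮) (m - + j) n → + j ≤ℤ + (N *ℕ n) + m
  F-withoutV-index-≤ {m} {j} {n} (q , qs , x , y) = begin
    + j                        ≡⟨ rearrange (+ j) m ⟩
    - (m - + j) + m            ≡⟨ cong (_+ m) (sym y) ⟩
    endY q + m                 ≤⟨ ℤ.+-monoˡ-≤ m (endY-≤ qs) ⟩
    + (N *ℕ length q) + m      ≡⟨ cong (λ l → + (N *ℕ l) + m) (length-V-free qs x) ⟩
    + (N *ℕ n) + m             ∎
    where
    open ℤ.≤-Reasoning
    rearrange : ∀ j m → j ≡ - (m - j) + m
    rearrange = solve-∀

  FShaped-size : (r : Shape → Bool) (m : ℤ) (n : ℕ) {c : ℕ → ℕ} {f : ℤ → ℕ} →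
    (∀ j → HasSize (Shapes r j n) (c j)) → (∀ m′ → HasSize (F (withoutV 𝒮) m′ n) (f m′)) →
    HasSize (FShaped (withV 𝒮) r m n) (sumUpTo (+ (N *ℕ n) + m) (λ j → c j *ℕ f (m - + j)))
  FShaped-size r m n shapes≅c F≅f = ↔-trans (Decomposition.decompose 𝒮 r m n)
    (HasSize-Σ-sumUpTo (+ (N *ℕ n) + m) (λ j → HasSize-× (shapes≅c j) (F≅f (m - + j)))
      λ _ (_ , q) → F-withoutV-index-≤ {m} q)

-- The cycle lemma

endX-++ : ∀ a b → endX (a ++ b) ≡ endX a + endX b
endX-++ []      b = sym (ℤ.+-identityˡ (endX b))
endX-++ (s ∷ a) b = trans (cong (λ x → dx s + x) (endX-++ a b)) (sym (ℤ.+-assoc (dx s) (endX a) (endX b)))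

endY-++ : ∀ a b → endY (a ++ b) ≡ endY a + endY b
endY-++ []      b = sym (ℤ.+-identityˡ (endY b))
endY-++ (s ∷ a) b = trans (cong (λ y → dy s + y) (endY-++ a b)) (sym (ℤ.+-assoc (dy s) (endY a) (endY b)))

aboveExceptLast? : ∀ h p → Dec (AboveExceptLast h p)
aboveExceptLast? h []      = yes tt
aboveExceptLast? h (s ∷ p) = (0ℤ ℤ.≤? h) ×-dec aboveExceptLast? (dy s + h) p

AboveExceptLast-irrelevant : ∀ h p → Irrelevant (AboveExceptLast h p)
AboveExceptLast-irrelevant h []      _       _       = refl
AboveExceptLast-irrelevant h (s ∷ p) (a , x) (b , y) =
  cong₂ _,_ (ℤ.≤-irrelevant a b) (AboveExceptLast-irrelevant (dy s + h) p x y)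

AboveExceptLast-mono : ∀ {h h′} p → h ≤ℤ h′ → AboveExceptLast h p → AboveExceptLast h′ p
AboveExceptLast-mono []      _    _       = tt
AboveExceptLast-mono (s ∷ p) h≤h′ (0≤h , x) =
  ℤ.≤-trans 0≤h h≤h′ , AboveExceptLast-mono p (ℤ.+-monoʳ-≤ (dy s) h≤h′) x

AboveExceptLast-≡ : ∀ {h h′} p → h ≡ h′ → AboveExceptLast h p → AboveExceptLast h′ p
AboveExceptLast-≡ p refl x = x

AboveExceptLast-head : ∀ {h} a → NonEmpty a → AboveExceptLast h a → 0ℤ ≤ℤ h
AboveExceptLast-head (_ ∷ _) _ (0≤h , _) = 0≤h

private
  height-assoc : ∀ d e h → e + (d + h) ≡ (d + e) + h
  height-assoc = solve-∀

AboveExceptLast-++⁻ : ∀ h a {b} → AboveExceptLast h (a ++ b) →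
  AboveExceptLast h a × AboveExceptLast (endY a + h) b
AboveExceptLast-++⁻ h []      {b} x = tt , AboveExceptLast-≡ b (sym (ℤ.+-identityˡ h)) x
AboveExceptLast-++⁻ h (s ∷ a) {b} (0≤h , x) =
  let xa , xb = AboveExceptLast-++⁻ (dy s + h) a x
  in (0≤h , xa) , AboveExceptLast-≡ b (height-assoc (dy s) (endY a) h) xb

AboveExceptLast-++⁺ : ∀ h a {b} → AboveExceptLast h a → AboveExceptLast (endY a + h) b →
  AboveExceptLast h (a ++ b)
AboveExceptLast-++⁺ h []      {b} _ xb = AboveExceptLast-≡ b (ℤ.+-identityˡ h) xb
AboveExceptLast-++⁺ h (s ∷ a) {b} (0≤h , xa) xb =
  0≤h , AboveExceptLast-++⁺ (dy s + h) a xa (AboveExceptLast-≡ b (sym (height-assoc (dy s) (endY a) h)) xb)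

-- The rotation a ++ b of b ++ a stays on or above the axis until it ends at height -1.
CycleCut : List Step → List Step → Set
CycleCut b a = NonEmpty a × AboveExceptLast 0ℤ a × AboveExceptLast (- 1ℤ - endY b) b

module _ {a b : List Step} (endY≡ : endY a + endY b ≡ - 1ℤ) where

  private
    start-of-b : endY a + 0ℤ ≡ - 1ℤ - endY b
    start-of-b = trans (move (endY a) (endY b)) (cong (_- endY b) endY≡)
      where
      move : ∀ x y → x + 0ℤ ≡ (x + y) - y
      move = solve-∀

  AboveExceptLast⇒CycleCut : NonEmpty a → AboveExceptLast 0ℤ (a ++ b) → CycleCut b a
  AboveExceptLast⇒CycleCut ne x =
    let xa , xb = AboveExceptLast-++⁻ 0ℤ a x in ne , xa , AboveExceptLast-≡ b start-of-b xb

  CycleCut⇒AboveExceptLast : CycleCut b a → AboveExceptLast 0ℤ (a ++ b)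
  CycleCut⇒AboveExceptLast (_ , xa , xb) =
    AboveExceptLast-++⁺ 0ℤ a xa (AboveExceptLast-≡ b (sym start-of-b) xb)

CycleCut-++ : ∀ {b a} h → CycleCut b a → 0ℤ ≤ℤ h + endY b → AboveExceptLast h (b ++ a)
CycleCut-++ {b} {a} h (_ , xa , xb) 0≤h+e =
  AboveExceptLast-++⁺ h b (AboveExceptLast-mono b start≤h xb)
    (AboveExceptLast-mono a (ℤ.≤-trans 0≤h+e (ℤ.≤-reflexive (ℤ.+-comm h (endY b)))) xa)
  where
  open ℤ.≤-Reasoning
  start≤h : - 1ℤ - endY b ≤ℤ h
  start≤h = begin
    - 1ℤ - endY b                   ≡⟨ ℤ.+-identityˡ (- 1ℤ - endY b) ⟨
    0ℤ + (- 1ℤ - endY b)            ≤⟨ ℤ.+-monoˡ-≤ (- 1ℤ - endY b) 0≤h+e ⟩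
    (h + endY b) + (- 1ℤ - endY b)  ≡⟨ cancel h (endY b) ⟩
    h + - 1ℤ                        ≤⟨ ℤ.+-monoʳ-≤ h -≤+ ⟩
    h + 0ℤ                          ≡⟨ ℤ.+-identityʳ h ⟩
    h                               ∎
    where
    cancel : ∀ h e → (h + e) + (- 1ℤ - e) ≡ h + - 1ℤ
    cancel = solve-∀

-- factor q = (b , a) with a the longest nonempty suffix of q that, started at height 0,
-- stays on or above the axis before its last point.
factor : List Step → List Step × List Step
factor []      = [] , []
factor (x ∷ q) with aboveExceptLast? (dy x) q
... | yes _ = [] , x ∷ q
... | no  _ = map₁ (x ∷_) (factor q)

factor-++ : ∀ q → proj₁ (factor q) ++ proj₂ (factor q) ≡ q
factor-++ []      = refl
factor-++ (x ∷ q) with aboveExceptLast? (dy x) q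
... | yes _ = refl
... | no  _ = cong (x ∷_) (factor-++ q)

private
  start-after-step : ∀ d e → - 1ℤ - e ≡ d + (- 1ℤ - (d + e))
  start-after-step = solve-∀

¬0≤⇒0≤-1- : ∀ z → ¬ (0ℤ ≤ℤ z) → 0ℤ ≤ℤ - 1ℤ - z
¬0≤⇒0≤-1- (+ _)    z≱0 = ⊥-elim (z≱0 (+≤+ z≤n))
¬0≤⇒0≤-1- -[1+ _ ] _   = +≤+ z≤n

factor-CycleCut : ∀ q → NonEmpty q → CycleCut (proj₁ (factor q)) (proj₂ (factor q))
factor-CycleCut (x ∷ [])    _ = tt , (ℤ.≤-refl , tt) , tt
factor-CycleCut (x ∷ y ∷ r) _ with aboveExceptLast? (dy x) (y ∷ r) | factor-CycleCut (y ∷ r) tt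
... | yes xq  | _ = tt , (ℤ.≤-refl , AboveExceptLast-≡ (y ∷ r) (sym (ℤ.+-identityʳ (dy x))) xq) , tt
... | no  ¬xq | cut@(ne , xa , xb) =
  ne , xa , ¬0≤⇒0≤-1- (dy x + endY b) b-too-low , AboveExceptLast-≡ b (start-after-step (dy x) (endY b)) xb
  where
  b : List Step
  b = proj₁ (factor (y ∷ r))
  b-too-low : ¬ (0ℤ ≤ℤ dy x + endY b)
  b-too-low 0≤ = ¬xq (subst (AboveExceptLast (dy x)) (factor-++ (y ∷ r)) (CycleCut-++ (dy x) cut 0≤))

factor-unique : ∀ b {a} → CycleCut b a → factor (b ++ a) ≡ (b , a)
factor-unique [] {x ∷ q} (_ , (_ , xq) , _) with aboveExceptLast? (dy x) q
... | yes _   = refl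
... | no  ¬xq = ⊥-elim (¬xq (AboveExceptLast-≡ q (ℤ.+-identityʳ (dy x)) xq))
factor-unique (x ∷ b) {a} (ne , xa , 0≤ , xb) with aboveExceptLast? (dy x) (b ++ a)
... | yes x-ba = ⊥-elim (0≰-1 (subst (0ℤ ≤ℤ_) (cancel (dy x) (endY b))
                   (ℤ.+-mono-≤ (AboveExceptLast-head a ne (proj₂ (AboveExceptLast-++⁻ (dy x) b x-ba))) 0≤)))
  where
  cancel : ∀ d e → (e + d) + (- 1ℤ - (d + e)) ≡ - 1ℤ
  cancel = solve-∀
  0≰-1 : ¬ (0ℤ ≤ℤ - 1ℤ)
  0≰-1 ()
... | no  _    =
  cong (map₁ (x ∷_)) (factor-unique b (ne , xa , AboveExceptLast-≡ b (sym (start-after-step (dy x) (endY b))) xb))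

-- Cuts just after the (i+1)-th S-step.
splitAfterS : ℕ → List Step → List Step × List Step
splitAfterS _       []        = [] , []
splitAfterS i       (V   ∷ p) = map₁ (V ∷_) (splitAfterS i p)
splitAfterS zero    (S k ∷ p) = S k ∷ [] , p
splitAfterS (suc i) (S k ∷ p) = map₁ (S k ∷_) (splitAfterS i p)

splitAfterS-++ : ∀ i p → proj₁ (splitAfterS i p) ++ proj₂ (splitAfterS i p) ≡ p
splitAfterS-++ _       []        = refl
splitAfterS-++ i       (V   ∷ p) = cong (V ∷_) (splitAfterS-++ i p)
splitAfterS-++ zero    (S k ∷ p) = refl
splitAfterS-++ (suc i) (S k ∷ p) = cong (S k ∷_) (splitAfterS-++ i p)

splitAfterS-prefix : ∀ i p → i < #S (shape p) →
  let a = proj₁ (splitAfterS i p) in T (endsInS (shape a)) × #S (shape a) ≡ suc i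
splitAfterS-prefix i       (V   ∷ p) i<#S =
  let endsS , #S≡ = splitAfterS-prefix i p i<#S in endsInS-∷ true (shape (proj₁ (splitAfterS i p))) endsS , #S≡
splitAfterS-prefix zero    (S k ∷ p) _    = tt , refl
splitAfterS-prefix (suc i) (S k ∷ p) i<#S =
  let endsS , #S≡ = splitAfterS-prefix i p (ℕ.≤-pred i<#S)
  in endsInS-∷ false (shape (proj₁ (splitAfterS i p))) endsS , cong suc #S≡

splitAfterS-inverse : ∀ i a b → T (endsInS (shape a)) → #S (shape a) ≡ suc i →
  splitAfterS i (a ++ b) ≡ (a , b)
splitAfterS-inverse i       (V ∷ y ∷ a) b endsS #S≡ =
  cong (map₁ (V ∷_)) (splitAfterS-inverse i (y ∷ a) b endsS #S≡)
splitAfterS-inverse zero    (S k ∷ [])  b _     _   = refl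
splitAfterS-inverse zero    (S k ∷ y ∷ a) b endsS #S≡ =
  ⊥-elim (ℕ.<-irrefl (sym (ℕ.suc-injective #S≡)) (endsInS⇒0<#S (shape (y ∷ a)) endsS))
splitAfterS-inverse (suc i) (S k ∷ y ∷ a) b endsS #S≡ =
  cong (map₁ (S k ∷_)) (splitAfterS-inverse i (y ∷ a) b endsS (ℕ.suc-injective #S≡))

endsInS-shape⇒NonEmpty : ∀ p → T (endsInS (shape p)) → NonEmpty p
endsInS-shape⇒NonEmpty (_ ∷ _) _ = tt

endsInS-shape-++ : ∀ b a → NonEmpty a → endsInS (shape (b ++ a)) ≡ endsInS (shape a)
endsInS-shape-++ b a@(_ ∷ _) _ = trans (cong endsInS (map-++ isV b a)) (endsInS-++ (shape b) (shape a) tt)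

suc-pred-#S : ∀ a → T (endsInS (shape a)) → suc (pred (#S (shape a))) ≡ #S (shape a)
suc-pred-#S a endsS = ℕ.suc-pred (#S (shape a)) {{>-nonZero (endsInS⇒0<#S (shape a) endsS)}}

#S-shape-++ : ∀ a b → #S (shape (a ++ b)) ≡ #S (shape a) +ℕ #S (shape b)
#S-shape-++ a b = trans (cong #S (map-++ isV a b)) (#S-++ (shape a) (shape b))

PathTo-swap : ∀ {𝒮 m n} a b → PathTo 𝒮 m n (a ++ b) → PathTo 𝒮 m n (b ++ a)
PathTo-swap a b (ps , x , y) =
  let pa , pb = ++⁻ a ps in
  ++⁺ pb pa ,
  trans (endX-++ b a) (trans (ℤ.+-comm (endX b) (endX a)) (trans (sym (endX-++ a b)) x)) ,
  trans (endY-++ b a) (trans (ℤ.+-comm (endY b) (endY a)) (trans (sym (endY-++ a b)) y))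

module _ (𝒱 : StepSet) (n : ℕ) where

  IsPPath : List Step → Set
  IsPPath p = IsPath 𝒱 p × endX p ≡ + n × endY p ≡ - 1ℤ × AboveExceptLast 0ℤ p

  IsPPath-irrelevant : ∀ p → Irrelevant (IsPPath p)
  IsPPath-irrelevant p = ×-irrelevant (IsPath-irrelevant 𝒱 p)
    (×-irrelevant ℤ-≡-irrelevant (×-irrelevant ℤ-≡-irrelevant (AboveExceptLast-irrelevant 0ℤ p)))

  MarkedSplit : List Step × List Step → Set
  MarkedSplit (a , b) = IsPPath (a ++ b) × T (endsInS (shape a))

  MarkedSplit-irrelevant : ∀ ab → Irrelevant (MarkedSplit ab)
  MarkedSplit-irrelevant (a , b) =
    ×-irrelevant (IsPPath-irrelevant (a ++ b)) (T-irrelevant {endsInS (shape a)})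

  mark-↔ : Σ (ℕ × List Step) (λ (i , p) → i < n × IsPPath p) ↔ Σ (List Step × List Step) MarkedSplit
  mark-↔ = subset-↔ (λ (_ , p) → ×-irrelevant ℕ.<-irrelevant (IsPPath-irrelevant p)) MarkedSplit-irrelevant
    (λ (i , p) → splitAfterS i p) (λ (a , b) → pred (#S (shape a)) , a ++ b)
    (λ {ip} → split-pres {ip}) (λ {ab} → merge-pres {ab})
    (λ {(i , p)} (i<n , _ , x , _) →
      cong₂ _,_ (cong pred (proj₂ (prefix {i} {p} i<n x))) (splitAfterS-++ i p))
    (λ {(a , b)} (_ , endsS) → splitAfterS-inverse _ a b endsS (sym (suc-pred-#S a endsS)))
    where
    prefix : ∀ {i p} → i < n → endX p ≡ + n →
      T (endsInS (shape (proj₁ (splitAfterS i p)))) × #S (shape (proj₁ (splitAfterS i p))) ≡ suc i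
    prefix {i} {p} i<n x = splitAfterS-prefix i p (subst (i <_) (sym (#S-shape p x)) i<n)

    split-pres : ∀ {ip} → proj₁ ip < n × IsPPath (proj₂ ip) → MarkedSplit (splitAfterS (proj₁ ip) (proj₂ ip))
    split-pres {i , p} (i<n , pp@(_ , x , _)) =
      subst IsPPath (sym (splitAfterS-++ i p)) pp , proj₁ (prefix {i} {p} i<n x)

    merge-pres : ∀ {ab} → MarkedSplit ab → pred (#S (shape (proj₁ ab))) < n × IsPPath (proj₁ ab ++ proj₂ ab)
    merge-pres {a , b} (pp@(_ , x , _) , endsS) = ℕ.≤-trans (ℕ.≤-reflexive (suc-pred-#S a endsS)) #S≤n , pp
      where
      #S≤n : #S (shape a) ≤ n
      #S≤n = subst (#S (shape a) ≤_) (trans (sym (#S-shape-++ a b)) (#S-shape (a ++ b) x))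
                   (ℕ.m≤m+n (#S (shape a)) (#S (shape b)))

  rotate-↔ : Σ (List Step × List Step) MarkedSplit ↔ FShaped 𝒱 endsInS 1ℤ n
  rotate-↔ = subset-↔ MarkedSplit-irrelevant
    (λ q → ×-irrelevant (PathTo-irrelevant 𝒱 1ℤ n q) (T-irrelevant {endsInS (shape q)}))
    (λ (a , b) → b ++ a) (swap ∘ factor)
    (λ {(a , b)} ((ps , x , y , _) , endsS) →
      PathTo-swap a b (ps , x , y) , subst T (sym (endsInS-shape-++ b a (endsInS-shape⇒NonEmpty a endsS))) endsS)
    (λ {q} → factor-pres {q})
    (λ {(a , b)} ((_ , _ , y , above) , endsS) →
      cong swap (factor-unique b
        (AboveExceptLast⇒CycleCut (trans (sym (endY-++ a b)) y) (endsInS-shape⇒NonEmpty a endsS) above)))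
    (λ {q} _ → factor-++ q)
    where
    factor-pres : ∀ {q} → PathTo 𝒱 1ℤ n q × T (endsInS (shape q)) → MarkedSplit (swap (factor q))
    factor-pres {q} (pq , endsS) =
      let ps , x , y = PathTo-swap b a (subst (PathTo 𝒱 1ℤ n) (sym (factor-++ q)) pq)
      in (ps , x , y , CycleCut⇒AboveExceptLast (trans (sym (endY-++ a b)) y) cut) ,
         subst T (endsInS-shape-++ b a (proj₁ cut)) (subst (T ∘ endsInS ∘ shape) (sym (factor-++ q)) endsS)
      where
      b a : List Step
      b = proj₁ (factor q)
      a = proj₂ (factor q)
      cut : CycleCut b a
      cut = factor-CycleCut q (endsInS-shape⇒NonEmpty q endsS)

  cycle-lemma : (Fin n × P 𝒱 1ℤ n) ↔ FShaped 𝒱 endsInS 1ℤ n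
  cycle-lemma = ↔-trans (Fin-×-↔ n IsPPath-irrelevant) (↔-trans mark-↔ rotate-↔)

module _ {N : ℕ} {𝒮 : StepSet} (bounded : ∀ k → T (𝒮 (S k)) → k ≤ℤ + N) {f : ℤ → ℕ} where

  F-withV-size : ∀ m n → (∀ m′ → HasSize (F (withoutV 𝒮) m′ n) (f m′)) →
    HasSize (F (withV 𝒮) m n) (sumUpTo (+ (N *ℕ n) + m) (λ j → ((n +ℕ j) C j) *ℕ f (m - + j)))
  F-withV-size m n F≅f = ↔-trans (F↔FShaped (withV 𝒮) m n)
    (FShaped-size bounded (λ _ → true) m n (λ j → AllShapes-size j n) F≅f)

  P-withV-size : ∀ n → (∀ m′ → HasSize (F (withoutV 𝒮) m′ (suc n)) (f m′)) →
    HasSize (Fin (suc n) × P (withV 𝒮) 1ℤ (suc n))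
            (sumUpTo (+ (N *ℕ suc n) + 1ℤ) (λ j → ((n +ℕ j) C j) *ℕ f (1ℤ - + j)))
  P-withV-size n F≅f = ↔-trans (cycle-lemma (withV 𝒮) (suc n))
    (FShaped-size bounded endsInS 1ℤ (suc n)
      (λ j → ↔-trans (↔-sym (AllShapes↔Shapes-endsInS j n)) (AllShapes-size j n)) F≅f)

mainTheorem3 : (N : ℕ) (𝒮 : StepSet) →
    (∀ k → T (𝒮 (S k)) → k ≤ℤ + N) →
    T (𝒮 (S (+ N))) →
    (n : ℕ) → 1 ≤ n → (m : ℤ) →
    (f : ℤ → ℕ) → (∀ m′ → HasSize (F (withoutV 𝒮) m′ n) (f m′)) →
    ((a : ℕ) → HasSize (F (withV 𝒮) m n) a →
      a ≡ sumUpTo (+ (N *ℕ n) + m) (λ j → ((n +ℕ j) C j) *ℕ f (m - + j)))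
    ×
    ((b : ℕ) → HasSize (P (withV 𝒮) 1ℤ n) b →
      n *ℕ b ≡ sumUpTo (+ (N *ℕ n) + 1ℤ) (λ j → (((n ∸ 1) +ℕ j) C j) *ℕ f (1ℤ - + j)))
mainTheorem3 N 𝒮 bounded _ (suc n) (s≤s _) m f F≅f =
  (λ a F≅a → HasSize-unique F≅a (F-withV-size bounded m (suc n) F≅f)) ,
  (λ b P≅b → HasSize-unique (HasSize-× ↔-refl P≅b) (P-withV-size bounded n F≅f))
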